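{- Let $h$ be an arithmetical function (defined on the positive integers, real-valued) for which there is $n_0$ such that $n\le h(n)\le \sigma(n)$ for every $n\ge n_0$. Then \[ \liminf_{n\to \infty} \frac{h(\sigma(n))}{n} =1. \]
   Context: $\sigma(n)$ is the sum of the positive divisors of $n$.
   Formalization: The arithmetical function h takes rational values rather than real values. -}

module Defs where

open import Data.Nat using (ℕ; zero; suc)
open import Data.Nat.Divisibility using (_∣?_)
open import Data.List using (List; upTo; map; filter)
open import Data.Nat.ListAction using (sum)
open import Data.Integer using (+_)
open import Data.Rational using (ℚ; _/_; _*_; _+_; _-_; _≤_; _<_; 0ℚ; 1ℚ)
open import Data.Product using (Σ; ∃; _×_)

-- sum of the positive divisors of n (σ 0 = 0, irrelevant)
σ : ℕ → ℕ
σ n = sum (filter (_∣? n) (map suc (upTo n)))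

⟦_⟧ : ℕ → ℚ
⟦ n ⟧ = (+ n) / 1

-- q / n for a positive integer n (value at n = 0 is an irrelevant convention)
_÷ℕ_ : ℚ → ℕ → ℚ
q ÷ℕ zero = 0ℚ
q ÷ℕ suc k = q * ((+ 1) / suc k)

-- liminf_{n→∞} f n = L, written out by its ε–N definition (ε ranging over positive rationals)
LimInfEq : (ℕ → ℚ) → ℚ → Set
LimInfEq f L = (ε : ℚ) → 0ℚ < ε →
  (∃ λ N → (n : ℕ) → N Data.Nat.≤ n → L - ε ≤ f n)
  × ((N : ℕ) → ∃ λ n → N Data.Nat.≤ n × f n ≤ L + ε)

module Submission where

-- Since h (σ n) ≥ σ n ≥ n, only the upper bound needs work. Given K, take primes p > 2K + 1 and
-- q > p^(4K) and put n = p^(q-1). Then σ n = 1 + p + ⋯ + p^(q-1) < n · p / (p - 1), and every prime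
-- factor r of σ n is at least q: if r < q, the order of p modulo r is a proper divisor of q, so p ≡ 1
-- and σ n ≡ q (mod r), forcing r = q.
-- Since σ n < p^q, it has j < q / 4K prime factors, whence σ (σ n) / σ n ≤ (1 + 1/q)^j ≤ 1 + 1/2K.
-- As p / (p - 1) ≤ 1 + 1/(2K + 1), this gives h (σ n) / n ≤ σ (σ n) / n ≤ 1 + 1/K.

open import Defs

module DivisorSums where

  open import Data.Nat
  open import Data.Nat.Properties
  open import Data.Nat.Divisibility
  open import Data.Nat.Coprimality as Coprime using (Coprime; coprime-divisor)
  open import Data.Nat.Primality using (Prime; prime⇒irreducible; prime⇒nonZero; prime⇒nonTrivial)
  open import Data.List using ([]; _∷_; upTo; map; filter; _++_)
  import Data.List.Properties as List
  open import Data.Nat.ListAction using (sum)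
  open import Data.Nat.ListAction.Properties using (sum-++)
  open import Data.Product using (_,_)
  open import Data.Sum using (_⊎_; inj₁; inj₂)
  open import Relation.Nullary using (¬_; Dec; yes; no; contradiction)
  open import Relation.Binary.PropositionalEquality
  open import Data.Nat.Tactic.RingSolver using (solve-∀)

  sumTo : (ℕ → ℕ) → ℕ → ℕ
  sumTo f zero    = 0
  sumTo f (suc n) = sumTo f n + f (suc n)

  sumTo-cong : ∀ {f g} n → (∀ d → 0 < d → d ≤ n → f d ≡ g d) → sumTo f n ≡ sumTo g n
  sumTo-cong zero    f≡g = refl
  sumTo-cong (suc n) f≡g =
    cong₂ _+_ (sumTo-cong n (λ d 0<d d≤n → f≡g d 0<d (m≤n⇒m≤1+n d≤n))) (f≡g (suc n) z<s ≤-refl)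

  sumTo-mono-≤ : ∀ {f g} n → (∀ d → f d ≤ g d) → sumTo f n ≤ sumTo g n
  sumTo-mono-≤ zero    f≤g = z≤n
  sumTo-mono-≤ (suc n) f≤g = +-mono-≤ (sumTo-mono-≤ n f≤g) (f≤g (suc n))

  sumTo-+ : ∀ f g n → sumTo (λ d → f d + g d) n ≡ sumTo f n + sumTo g n
  sumTo-+ f g zero    = refl
  sumTo-+ f g (suc n) rewrite sumTo-+ f g n = lemma (sumTo f n) (sumTo g n) (f (suc n)) (g (suc n))
    where
    lemma : ∀ a b c e → a + b + (c + e) ≡ a + c + (b + e)
    lemma = solve-∀

  sumTo-*ˡ : ∀ c f n → sumTo (λ d → c * f d) n ≡ c * sumTo f n
  sumTo-*ˡ c f zero    = sym (*-zeroʳ c)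
  sumTo-*ˡ c f (suc n) rewrite sumTo-*ˡ c f n = sym (*-distribˡ-+ c (sumTo f n) (f (suc n)))

  sumTo-+-split : ∀ f m n → sumTo f (m + n) ≡ sumTo f m + sumTo (λ t → f (m + t)) n
  sumTo-+-split f m zero    = trans (cong (sumTo f) (+-identityʳ m)) (sym (+-identityʳ (sumTo f m)))
  sumTo-+-split f m (suc n) rewrite +-suc m n | sumTo-+-split f m n = +-assoc (sumTo f m) _ _

  sumTo-vanishing : ∀ f {m} n → m ≤ n → (∀ d → m < d → d ≤ n → f d ≡ 0) → sumTo f n ≡ sumTo f m
  sumTo-vanishing f {m} zero    z≤n f≡0 = refl
  sumTo-vanishing f {m} (suc n) m≤1+n f≡0 with m≤n⇒m<n∨m≡n m≤1+n
  ... | inj₂ refl = refl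
  ... | inj₁ m<1+n = begin
    sumTo f n + f (suc n) ≡⟨ cong₂ _+_ (sumTo-vanishing f n (s≤s⁻¹ m<1+n) (λ d m<d d≤n → f≡0 d m<d (m≤n⇒m≤1+n d≤n)))
                                       (f≡0 (suc n) m<1+n ≤-refl) ⟩
    sumTo f m + 0         ≡⟨ +-identityʳ (sumTo f m) ⟩
    sumTo f m             ∎
    where open ≡-Reasoning

  sumTo-onlyLast : ∀ f n → (∀ d → 0 < d → d ≤ n → f d ≡ 0) → sumTo f (suc n) ≡ f (suc n)
  sumTo-onlyLast f n f≡0 = cong (_+ f (suc n)) (sumTo-vanishing f n z≤n f≡0)

  sumTo-multiples : ∀ g r .{{_ : NonZero r}} M → (∀ d → ¬ r ∣ d → g d ≡ 0) →
                    sumTo g (r * M) ≡ sumTo (λ e → g (r * e)) M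
  sumTo-multiples g r zero    g≡0 = cong (sumTo g) (*-zeroʳ r)
  sumTo-multiples g r@(suc k) (suc M) g≡0 = begin
    sumTo g (r * suc M)                              ≡⟨ cong (sumTo g) (trans (*-suc r M) (+-comm r (r * M))) ⟩
    sumTo g (r * M + r)                              ≡⟨ sumTo-+-split g (r * M) r ⟩
    sumTo g (r * M) + sumTo (λ t → g (r * M + t)) r  ≡⟨ cong₂ _+_ (sumTo-multiples g r M g≡0) lastBlock ⟩
    sumTo (λ e → g (r * e)) M + g (r * suc M)        ∎
    where
    open ≡-Reasoning
    lastBlock : sumTo (λ t → g (r * M + t)) r ≡ g (r * suc M)
    lastBlock = trans (sumTo-onlyLast _ k (λ t 0<t t≤k → g≡0 _ (λ r∣ → <⇒≱ (s≤s t≤k) (∣⇒≤ ⦃ >-nonZero 0<t ⦄ (∣m+n∣m⇒∣n r∣ (m∣m*n M))))))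
                      (cong g (trans (+-comm (r * M) r) (sym (*-suc r M))))

  divisorTerm : ℕ → ℕ → ℕ
  divisorTerm x d with d ∣? x
  ... | yes _ = d
  ... | no  _ = 0

  divisorTerm-∣ : ∀ {x d} → d ∣ x → divisorTerm x d ≡ d
  divisorTerm-∣ {x} {d} d∣x with d ∣? x
  ... | yes _   = refl
  ... | no  d∤x = contradiction d∣x d∤x

  divisorTerm-∤ : ∀ {x d} → ¬ d ∣ x → divisorTerm x d ≡ 0
  divisorTerm-∤ {x} {d} d∤x with d ∣? x
  ... | yes d∣x = contradiction d∣x d∤x
  ... | no  _   = refl

  divisorTerm-cong : ∀ {x y d} → (d ∣ x → d ∣ y) → (d ∣ y → d ∣ x) → divisorTerm x d ≡ divisorTerm y d
  divisorTerm-cong {x} {y} {d} x⇒y y⇒x with d ∣? x | d ∣? y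
  ... | yes _   | yes _   = refl
  ... | yes d∣x | no  d∤y = contradiction (x⇒y d∣x) d∤y
  ... | no  d∤x | yes d∣y = contradiction (y⇒x d∣y) d∤x
  ... | no  _   | no  _   = refl

  sum-divisors≡sumTo : ∀ x n → sum (filter (_∣? x) (map suc (upTo n))) ≡ sumTo (divisorTerm x) n
  sum-divisors≡sumTo x zero    = refl
  sum-divisors≡sumTo x (suc n) = begin
    sum (filter (_∣? x) (map suc (upTo (suc n))))
      ≡⟨ cong (λ ds → sum (filter (_∣? x) ds)) (trans (cong (map suc) (sym (List.upTo-∷ʳ n))) (List.map-++ suc (upTo n) _)) ⟩
    sum (filter (_∣? x) (map suc (upTo n) ++ suc n ∷ []))
      ≡⟨ cong sum (List.filter-++ (_∣? x) (map suc (upTo n)) _) ⟩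
    sum (filter (_∣? x) (map suc (upTo n)) ++ filter (_∣? x) (suc n ∷ []))
      ≡⟨ sum-++ (filter (_∣? x) (map suc (upTo n))) _ ⟩
    sum (filter (_∣? x) (map suc (upTo n))) + sum (filter (_∣? x) (suc n ∷ []))
      ≡⟨ cong₂ _+_ (sum-divisors≡sumTo x n) (lastTerm (suc n ∣? x)) ⟩
    sumTo (divisorTerm x) n + divisorTerm x (suc n) ∎
    where
    open ≡-Reasoning
    lastTerm : Dec (suc n ∣ x) → sum (filter (_∣? x) (suc n ∷ [])) ≡ divisorTerm x (suc n)
    lastTerm (yes d∣x) = begin
      sum (filter (_∣? x) (suc n ∷ [])) ≡⟨ cong sum (List.filter-accept (_∣? x) d∣x) ⟩
      suc n + 0                         ≡⟨ +-identityʳ (suc n) ⟩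
      suc n                             ≡⟨ divisorTerm-∣ d∣x ⟨
      divisorTerm x (suc n)             ∎
    lastTerm (no d∤x) = trans (cong sum (List.filter-reject (_∣? x) d∤x)) (sym (divisorTerm-∤ d∤x))

  σ≡sumTo : ∀ x → σ x ≡ sumTo (divisorTerm x) x
  σ≡sumTo x = sum-divisors≡sumTo x x

  sumTo-divisorTerm≡σ : ∀ x .{{_ : NonZero x}} n → x ≤ n → sumTo (divisorTerm x) n ≡ σ x
  sumTo-divisorTerm≡σ x n x≤n =
    trans (sumTo-vanishing (divisorTerm x) n x≤n (λ d x<d _ → divisorTerm-∤ (>⇒∤ x<d))) (sym (σ≡sumTo x))

  n≤σ[n] : ∀ n .{{_ : NonZero n}} → n ≤ σ n
  n≤σ[n] n@(suc k) = begin
    n                                              ≤⟨ m≤n+m n _ ⟩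
    sumTo (divisorTerm n) k + n                    ≡⟨ cong (sumTo (divisorTerm n) k +_) (divisorTerm-∣ ∣-refl) ⟨
    sumTo (divisorTerm n) k + divisorTerm n n      ≡⟨ σ≡sumTo n ⟨
    σ n                                            ∎
    where open ≤-Reasoning

  σ-extend : ∀ P Q .{{_ : NonZero Q}} → Q < P → Q ∣ P → (∀ {d} → d ∣ P → d ∣ Q ⊎ d ≡ P) → σ P ≡ σ Q + P
  σ-extend P@(suc t) Q (s≤s Q≤t) Q∣P divisors = begin
    σ P                                             ≡⟨ σ≡sumTo P ⟩
    sumTo (divisorTerm P) t + divisorTerm P P       ≡⟨ cong₂ _+_ (sumTo-cong t sameBelow) (divisorTerm-∣ ∣-refl) ⟩
    sumTo (divisorTerm Q) t + P                     ≡⟨ cong (_+ P) (sumTo-divisorTerm≡σ Q t Q≤t) ⟩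
    σ Q + P                                         ∎
    where
    open ≡-Reasoning
    sameBelow : ∀ d → 0 < d → d ≤ t → divisorTerm P d ≡ divisorTerm Q d
    sameBelow d _ d≤t = divisorTerm-cong properDivisor (λ d∣Q → ∣-trans d∣Q Q∣P)
      where
      properDivisor : d ∣ P → d ∣ Q
      properDivisor d∣P with divisors d∣P
      ... | inj₁ d∣Q = d∣Q
      ... | inj₂ refl = contradiction d≤t (<⇒≱ ≤-refl)

  prime∤⇒coprime : ∀ {p n} → Prime p → ¬ p ∣ n → Coprime p n
  prime∤⇒coprime pr p∤n (d∣p , d∣n) with prime⇒irreducible pr d∣p
  ... | inj₁ d≡1  = d≡1
  ... | inj₂ refl = contradiction d∣n p∤n

  coprime∧∣^⇒≡1 : ∀ {e p} k → Coprime e p → e ∣ p ^ k → e ≡ 1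
  coprime∧∣^⇒≡1 zero    e⊥p e∣1   = ∣1⇒≡1 e∣1
  coprime∧∣^⇒≡1 (suc k) e⊥p e∣p^k = coprime∧∣^⇒≡1 k e⊥p (coprime-divisor e⊥p e∣p^k)

  ∣prime^suc⇒∣prime^⊎≡ : ∀ {p d} k → Prime p → d ∣ p ^ suc k → d ∣ p ^ k ⊎ d ≡ p ^ suc k
  ∣prime^suc⇒∣prime^⊎≡ {p} {d} k pr (divides e p^[1+k]≡e*d) with p ∣? e
  ... | yes (divides e/p refl) = inj₁ (divides e/p (*-cancelˡ-≡ (p ^ k) (e/p * d) p ⦃ prime⇒nonZero pr ⦄
                                     (trans p^[1+k]≡e*d (lemma e/p p d))))
    where
    lemma : ∀ a b c → a * b * c ≡ b * (a * c)
    lemma = solve-∀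
  ... | no p∤e = inj₂ (begin
    d          ≡⟨ *-identityˡ d ⟨
    1 * d      ≡⟨ cong (_* d) e≡1 ⟨
    e * d      ≡⟨ p^[1+k]≡e*d ⟨
    p ^ suc k  ∎)
    where
    open ≡-Reasoning
    e≡1 : e ≡ 1
    e≡1 = coprime∧∣^⇒≡1 (suc k) (Coprime.sym (prime∤⇒coprime pr p∤e))
                        (divides d (trans p^[1+k]≡e*d (*-comm e d)))

  geometricSum : ℕ → ℕ → ℕ
  geometricSum p zero    = 0
  geometricSum p (suc k) = geometricSum p k + p ^ k

  geometricSum-*-+1 : ∀ p k → geometricSum p k * p + 1 ≡ geometricSum p k + p ^ k
  geometricSum-*-+1 p zero    = refl
  geometricSum-*-+1 p (suc k) = begin
    (G + p ^ k) * p + 1       ≡⟨ lemma G (p ^ k) p ⟩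
    (G * p + 1) + p ^ k * p   ≡⟨ cong₂ _+_ (geometricSum-*-+1 p k) (*-comm (p ^ k) p) ⟩
    (G + p ^ k) + p ^ suc k   ∎
    where
    open ≡-Reasoning
    G = geometricSum p k
    lemma : ∀ a b c → (a + b) * c + 1 ≡ (a * c + 1) + b * c
    lemma = solve-∀

  geometricSum-closedForm : ∀ p q → geometricSum (suc p) q * p + 1 ≡ suc p ^ q
  geometricSum-closedForm p q = +-cancelˡ-≡ G (G * p + 1) (suc p ^ q) (begin
    G + (G * p + 1)    ≡⟨ +-assoc G (G * p) 1 ⟨
    G + G * p + 1      ≡⟨ cong (_+ 1) (*-suc G p) ⟨
    G * suc p + 1      ≡⟨ geometricSum-*-+1 (suc p) q ⟩
    G + suc p ^ q      ∎)
    where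
    open ≡-Reasoning
    G = geometricSum (suc p) q

  σ[p^k]≡geometricSum : ∀ {p} k → Prime p → σ (p ^ k) ≡ geometricSum p (suc k)
  σ[p^k]≡geometricSum zero          pr = refl
  σ[p^k]≡geometricSum {p} (suc k) pr = begin
    σ (p ^ suc k)                      ≡⟨ σ-extend (p ^ suc k) (p ^ k) p^k<p^[1+k] (n∣m*n p) (∣prime^suc⇒∣prime^⊎≡ k pr) ⟩
    σ (p ^ k) + p ^ suc k              ≡⟨ cong (_+ p ^ suc k) (σ[p^k]≡geometricSum k pr) ⟩
    geometricSum p (suc (suc k))       ∎
    where
    open ≡-Reasoning
    instance
      _ = prime⇒nonZero pr
      _ = m^n≢0 p k
    p^k<p^[1+k] : p ^ k < p ^ suc k
    p^k<p^[1+k] = ^-monoʳ-< p (nonTrivial⇒n>1 p ⦃ prime⇒nonTrivial pr ⦄) (n<1+n k)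

  onMultiplesOf : ℕ → (ℕ → ℕ) → ℕ → ℕ
  onMultiplesOf r f d with r ∣? d
  ... | yes _ = f d
  ... | no  _ = 0

  onMultiplesOf-∣ : ∀ {r f d} → r ∣ d → onMultiplesOf r f d ≡ f d
  onMultiplesOf-∣ {r} {f} {d} r∣d with r ∣? d
  ... | yes _   = refl
  ... | no  r∤d = contradiction r∣d r∤d

  onMultiplesOf-∤ : ∀ {r f d} → ¬ r ∣ d → onMultiplesOf r f d ≡ 0
  onMultiplesOf-∤ {r} {f} {d} r∤d with r ∣? d
  ... | yes r∣d = contradiction r∣d r∤d
  ... | no  _   = refl

  -- A divisor of p * m either divides m or is p times a divisor of m.
  σ[p*m]≤σ[m]+p*σ[m] : ∀ {p} m .{{_ : NonZero m}} → Prime p → σ (p * m) ≤ σ m + p * σ m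
  σ[p*m]≤σ[m]+p*σ[m] {p} m pr = begin
    σ (p * m)                                              ≡⟨ σ≡sumTo (p * m) ⟩
    sumTo (divisorTerm (p * m)) (p * m)                    ≤⟨ sumTo-mono-≤ (p * m) split ⟩
    sumTo (λ d → divisorTerm m d + multiples d) (p * m)    ≡⟨ sumTo-+ (divisorTerm m) multiples (p * m) ⟩
    sumTo (divisorTerm m) (p * m) + sumTo multiples (p * m) ≡⟨ cong₂ _+_ (sumTo-divisorTerm≡σ m (p * m) (m≤n*m m p))
                                                                       (sumTo-multiples multiples p m (λ _ → onMultiplesOf-∤)) ⟩
    σ m + sumTo (λ e → multiples (p * e)) m                ≡⟨ cong (σ m +_) (sumTo-cong m (λ e _ _ → multiples[p*e] e)) ⟩
    σ m + sumTo (λ e → p * divisorTerm m e) m              ≡⟨ cong (σ m +_) (sumTo-*ˡ p (divisorTerm m) m) ⟩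
    σ m + p * sumTo (divisorTerm m) m                      ≡⟨ cong (λ s → σ m + p * s) (σ≡sumTo m) ⟨
    σ m + p * σ m                                          ∎
    where
    open ≤-Reasoning
    instance _ = prime⇒nonZero pr
    multiples : ℕ → ℕ
    multiples = onMultiplesOf p (divisorTerm (p * m))
    split : ∀ d → divisorTerm (p * m) d ≤ divisorTerm m d + multiples d
    split d = cases (d ∣? p * m) (p ∣? d)
      where
      cases : Dec (d ∣ p * m) → Dec (p ∣ d) → divisorTerm (p * m) d ≤ divisorTerm m d + multiples d
      cases (no  d∤pm) _         = subst (_≤ divisorTerm m d + multiples d) (sym (divisorTerm-∤ d∤pm)) z≤n
      cases (yes _)    (yes p∣d) = subst (λ x → divisorTerm (p * m) d ≤ divisorTerm m d + x) (sym (onMultiplesOf-∣ p∣d))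
                                         (m≤n+m (divisorTerm (p * m) d) (divisorTerm m d))
      cases (yes d∣pm) (no  p∤d) = ≤-trans (≤-reflexive (trans (divisorTerm-∣ d∣pm) (sym (divisorTerm-∣ d∣m))))
                                           (m≤m+n (divisorTerm m d) (multiples d))
        where
        d∣m : d ∣ m
        d∣m = coprime-divisor (Coprime.sym (prime∤⇒coprime pr p∤d)) d∣pm
    multiples[p*e] : ∀ e → multiples (p * e) ≡ p * divisorTerm m e
    multiples[p*e] e = trans (onMultiplesOf-∣ {p} {divisorTerm (p * m)} (m∣m*n e)) (cases (e ∣? m))
      where
      cases : Dec (e ∣ m) → divisorTerm (p * m) (p * e) ≡ p * divisorTerm m e
      cases (yes e∣m) = trans (divisorTerm-∣ (*-monoʳ-∣ p e∣m)) (cong (p *_) (sym (divisorTerm-∣ e∣m)))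
      cases (no  e∤m) = begin-equality
        divisorTerm (p * m) (p * e) ≡⟨ divisorTerm-∤ (λ pe∣pm → e∤m (*-cancelˡ-∣ p pe∣pm)) ⟩
        0                           ≡⟨ *-zeroʳ p ⟨
        p * 0                       ≡⟨ cong (p *_) (divisorTerm-∤ e∤m) ⟨
        p * divisorTerm m e         ∎

module PowersModulo where

  open DivisorSums using (geometricSum; geometricSum-*-+1)
  open import Data.Nat
  open import Data.Nat.Properties
  open import Data.Nat.DivMod
  open import Data.Nat.Divisibility
  open import Data.Nat.GCD using (module Bézout)
  open import Data.Nat.Coprimality using (Coprime; coprime-Bézout; prime⇒coprime)
  open import Data.Nat.Primality using (Prime; prime⇒irreducible; prime⇒nonTrivial)
  open import Data.Fin using (toℕ)
  import Data.Fin.Properties as Fin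
  open import Data.Product using (∃; _×_; _,_)
  open import Data.Sum using (inj₁; inj₂)
  open import Relation.Nullary using (¬_)
  open import Relation.Binary.PropositionalEquality

  module _ {r : ℕ} .{{_ : NonTrivial r}} where

    private instance
      r≢0 : NonZero r
      r≢0 = nonTrivial⇒nonZero r

    1%r≡1 : 1 % r ≡ 1
    1%r≡1 = m<n⇒m%n≡m (nonTrivial⇒n>1 r)

    %-cong-*ʳ : ∀ {x y} z → x % r ≡ y % r → (x * z) % r ≡ (y * z) % r
    %-cong-*ʳ {x} {y} z x≡y = begin
      (x * z) % r                ≡⟨ %-distribˡ-* x z r ⟩
      ((x % r) * (z % r)) % r    ≡⟨ cong (λ w → (w * (z % r)) % r) x≡y ⟩
      ((y % r) * (z % r)) % r    ≡⟨ %-distribˡ-* y z r ⟨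
      (y * z) % r                ∎
      where open ≡-Reasoning

    %≡1⇒*-%-identityˡ : ∀ {x} y → x % r ≡ 1 → (x * y) % r ≡ y % r
    %≡1⇒*-%-identityˡ {x} y x≡1 = trans (%-cong-*ʳ y (trans x≡1 (sym 1%r≡1))) (cong (_% r) (*-identityˡ y))

    %≡1⇒^-%≡1 : ∀ {x} j → x % r ≡ 1 → (x ^ j) % r ≡ 1
    %≡1⇒^-%≡1 zero    x≡1 = 1%r≡1
    %≡1⇒^-%≡1 (suc j) x≡1 = trans (%≡1⇒*-%-identityˡ _ x≡1) (%≡1⇒^-%≡1 j x≡1)

    module _ {p : ℕ} where

      ^-%≡1-*ˡ : ∀ {a} k → (p ^ a) % r ≡ 1 → (p ^ (k * a)) % r ≡ 1
      ^-%≡1-*ˡ {a} k p^a≡1 = subst (λ e → (p ^ e) % r ≡ 1) (*-comm a k)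
        (subst (λ x → x % r ≡ 1) (^-*-assoc p a k) (%≡1⇒^-%≡1 k p^a≡1))

      ^-%≡1-+ : ∀ {a} b → (p ^ a) % r ≡ 1 → (p ^ (a + b)) % r ≡ (p ^ b) % r
      ^-%≡1-+ {a} b p^a≡1 = trans (cong (_% r) (^-distribˡ-+-* p a b)) (%≡1⇒*-%-identityˡ (p ^ b) p^a≡1)

      ^-%≡1-consecutive : ∀ {c d} → 1 + c ≡ d → (p ^ c) % r ≡ 1 → (p ^ d) % r ≡ 1 → p % r ≡ 1
      ^-%≡1-consecutive {c} {d} 1+c≡d p^c≡1 p^d≡1 = begin
        p % r              ≡⟨ cong (_% r) (^-identityʳ p) ⟨
        (p ^ 1) % r        ≡⟨ ^-%≡1-+ {c} 1 p^c≡1 ⟨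
        (p ^ (c + 1)) % r  ≡⟨ cong (λ e → (p ^ e) % r) (trans (+-comm c 1) 1+c≡d) ⟩
        (p ^ d) % r        ≡⟨ p^d≡1 ⟩
        1                  ∎
        where open ≡-Reasoning

      ^-%≡1-coprime : ∀ {a b} → Coprime a b → (p ^ a) % r ≡ 1 → (p ^ b) % r ≡ 1 → p % r ≡ 1
      ^-%≡1-coprime {a} {b} a⊥b p^a≡1 p^b≡1 with coprime-Bézout a⊥b
      ... | Bézout.+- x y 1+yb≡xa = ^-%≡1-consecutive 1+yb≡xa (^-%≡1-*ˡ y p^b≡1) (^-%≡1-*ˡ x p^a≡1)
      ... | Bézout.-+ x y 1+xa≡yb = ^-%≡1-consecutive 1+xa≡yb (^-%≡1-*ˡ x p^a≡1) (^-%≡1-*ˡ y p^b≡1)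

      geometricSum-% : ∀ k → p % r ≡ 1 → geometricSum p k % r ≡ k % r
      geometricSum-% zero    p≡1 = refl
      geometricSum-% (suc k) p≡1 = begin
        (geometricSum p k + p ^ k) % r               ≡⟨ %-distribˡ-+ (geometricSum p k) (p ^ k) r ⟩
        (geometricSum p k % r + (p ^ k) % r) % r     ≡⟨ cong₂ (λ a b → (a + b) % r) (geometricSum-% k p≡1)
                                                                                      (trans (%≡1⇒^-%≡1 k p≡1) (sym 1%r≡1)) ⟩
        (k % r + 1 % r) % r                          ≡⟨ %-distribˡ-+ k 1 r ⟨
        (k + 1) % r                                  ≡⟨ cong (_% r) (+-comm k 1) ⟩
        suc k % r                                    ∎
        where open ≡-Reasoning

      -- Among p^0, …, p^(q-1) two powers p^i, p^j (i < j) agree modulo r, and then p^(i + (q - j)) ≡ p^q.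
      short-period : ∀ {q} → r < q → (p ^ q) % r ≡ 1 → ∃ λ e → 0 < e × e < q × (p ^ e) % r ≡ 1
      short-period {q} r<q p^q≡1
        with i , j , i<j , same ← Fin.pigeonhole r<q (λ i → (p ^ toℕ i) mod r) = e , 0<e , e<q , p^e≡1
        where
        a = toℕ i
        b = toℕ j
        b<q : b < q
        b<q = Fin.toℕ<n j
        e = a + (q ∸ b)
        0<e : 0 < e
        0<e = ≤-trans (m<n⇒0<n∸m b<q) (m≤n+m (q ∸ b) a)
        e<q : e < q
        e<q = subst (e <_) (m+[n∸m]≡n (<⇒≤ b<q)) (+-monoˡ-< (q ∸ b) i<j)
        p^a≡p^b : (p ^ a) % r ≡ (p ^ b) % r
        p^a≡p^b = trans (sym (Fin.toℕ-fromℕ< _)) (trans (cong toℕ same) (Fin.toℕ-fromℕ< _))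
        p^e≡1 : (p ^ e) % r ≡ 1
        p^e≡1 = begin
          (p ^ (a + (q ∸ b))) % r      ≡⟨ cong (_% r) (^-distribˡ-+-* p a (q ∸ b)) ⟩
          (p ^ a * p ^ (q ∸ b)) % r    ≡⟨ %-cong-*ʳ (p ^ (q ∸ b)) p^a≡p^b ⟩
          (p ^ b * p ^ (q ∸ b)) % r    ≡⟨ cong (_% r) (^-distribˡ-+-* p b (q ∸ b)) ⟨
          (p ^ (b + (q ∸ b))) % r      ≡⟨ cong (λ x → (p ^ x) % r) (m+[n∸m]≡n (<⇒≤ b<q)) ⟩
          (p ^ q) % r                  ≡⟨ p^q≡1 ⟩
          1                            ∎
          where open ≡-Reasoning

      ∣geometricSum⇒^-%≡1 : ∀ q → r ∣ geometricSum p q → (p ^ q) % r ≡ 1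
      ∣geometricSum⇒^-%≡1 q r∣G = begin
        (p ^ q) % r      ≡⟨ %-remove-+ˡ (p ^ q) r∣G ⟨
        (G + p ^ q) % r  ≡⟨ cong (_% r) (geometricSum-*-+1 p q) ⟨
        (G * p + 1) % r  ≡⟨ %-remove-+ˡ 1 (∣m⇒∣m*n p r∣G) ⟩
        1 % r            ≡⟨ 1%r≡1 ⟩
        1                ∎
        where
        open ≡-Reasoning
        G = geometricSum p q

  prime∣geometricSum⇒≤ : ∀ {p q r} → Prime q → Prime r → r ∣ geometricSum p q → q ≤ r
  prime∣geometricSum⇒≤ {p} {q} {r} prq prr r∣G = ≮⇒≥ r≮q
    where
    instance
      _ = prime⇒nonTrivial prr
      _ = nonTrivial⇒nonZero r
    p^q≡1 : (p ^ q) % r ≡ 1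
    p^q≡1 = ∣geometricSum⇒^-%≡1 q r∣G
    r≮q : ¬ r < q
    r≮q r<q = r∤q r∣q
      where
      p≡1 : p % r ≡ 1
      p≡1 with e , 0<e , e<q , p^e≡1 ← short-period r<q p^q≡1 =
        ^-%≡1-coprime (prime⇒coprime prq ⦃ >-nonZero 0<e ⦄ e<q) p^q≡1 p^e≡1
      r∣q : r ∣ q
      r∣q = m%n≡0⇒n∣m q r (begin
        q % r                 ≡⟨ geometricSum-% q p≡1 ⟨
        geometricSum p q % r  ≡⟨ n∣m⇒m%n≡0 _ r r∣G ⟩
        0                     ∎)
        where open ≡-Reasoning
      r∤q : ¬ r ∣ q
      r∤q r∣q with prime⇒irreducible prq r∣q
      ... | inj₁ refl = nonTrivial⇒≢1 refl
      ... | inj₂ refl = <-irrefl refl r<q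

module SigmaOfSigma where

  open DivisorSums
  open PowersModulo using (prime∣geometricSum⇒≤)
  open import Data.Nat
  open import Data.Nat.Properties
  open import Data.Nat.Divisibility
  open import Data.Nat.Primality using (Prime; prime⇒nonTrivial; productOfPrimes≢0)
  open import Data.Nat.Primality.Factorisation using (PrimeFactorisation; factorise)
  open import Data.Nat.ListAction using (product)
  open import Data.Nat.ListAction.Properties using (∈⇒∣product)
  open import Data.List using ([]; _∷_; length)
  open import Data.List.Relation.Unary.All as All using (All; []; _∷_)
  open import Data.Product using (∃; _×_; _,_)
  open import Relation.Nullary using (¬_; contradiction)
  open import Relation.Binary.PropositionalEquality
  open import Data.Nat.Tactic.RingSolver using (solve-∀)

  ^length≤product : ∀ {B rs} → All (B ≤_) rs → B ^ length rs ≤ product rs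
  ^length≤product []           = ≤-refl
  ^length≤product (B≤r ∷ B≤rs) = *-mono-≤ B≤r (^length≤product B≤rs)

  -- σ (r y) ≤ (1 + r) σ y and (1 + r) / r ≤ (1 + B) / B for every prime factor r.
  σ[product]*^length≤ : ∀ {B rs} → All Prime rs → All (B ≤_) rs →
                        σ (product rs) * B ^ length rs ≤ product rs * suc B ^ length rs
  σ[product]*^length≤             []         []           = ≤-refl
  σ[product]*^length≤ {B} {r ∷ rs} (pr ∷ prs) (B≤r ∷ B≤rs) = begin
    σ (r * y) * (B * B ^ j)            ≤⟨ *-monoˡ-≤ (B * B ^ j) (σ[p*m]≤σ[m]+p*σ[m] y pr) ⟩
    suc r * σ y * (B * B ^ j)          ≡⟨ lemma (suc r) (σ y) B (B ^ j) ⟩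
    (suc r * B) * (σ y * B ^ j)        ≤⟨ *-mono-≤ [1+r]*B≤r*[1+B] (σ[product]*^length≤ prs B≤rs) ⟩
    (r * suc B) * (y * suc B ^ j)      ≡⟨ lemma r (suc B) y (suc B ^ j) ⟩
    r * y * (suc B * suc B ^ j)        ∎
    where
    open ≤-Reasoning
    instance _ = productOfPrimes≢0 prs
    y = product rs
    j = length rs
    [1+r]*B≤r*[1+B] : suc r * B ≤ r * suc B
    [1+r]*B≤r*[1+B] = subst (suc r * B ≤_) (sym (*-suc r B)) (+-monoˡ-≤ (r * B) B≤r)
    lemma : ∀ a b c d → a * b * (c * d) ≡ a * c * (b * d)
    lemma = solve-∀

  σ-large-prime-factors : ∀ m .{{_ : NonZero m}} B → (∀ {r} → Prime r → r ∣ m → B ≤ r) →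
                          ∃ λ j → B ^ j ≤ m × σ m * B ^ j ≤ m * suc B ^ j
  σ-large-prime-factors m B large = length rs , subst (B ^ length rs ≤_) (sym m≡∏) (^length≤product B≤rs)
                                              , subst (λ x → σ x * B ^ length rs ≤ x * suc B ^ length rs) (sym m≡∏)
                                                      (σ[product]*^length≤ prs B≤rs)
    where
    open PrimeFactorisation (factorise m) renaming (factors to rs; isFactorisation to m≡∏; factorsPrime to prs)
    B≤rs : All (B ≤_) rs
    B≤rs = All.tabulate (λ {r} r∈rs → large (All.lookup prs r∈rs) (subst (r ∣_) (sym m≡∏) (∈⇒∣product r∈rs)))

  B*[1+B]^j≤B^j*[B+2j] : ∀ B j → 2 * j ≤ B → B * suc B ^ j ≤ B ^ j * (B + 2 * j)
  B*[1+B]^j≤B^j*[B+2j] B zero    _    = ≤-reflexive (lemma B)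
    where
    lemma : ∀ B → B * 1 ≡ 1 * (B + 2 * 0)
    lemma = solve-∀
  B*[1+B]^j≤B^j*[B+2j] B (suc j) 2j≤B = begin
    B * (suc B * suc B ^ j)                   ≡⟨ lemma₁ B (suc B) (suc B ^ j) ⟩
    suc B * (B * suc B ^ j)                   ≤⟨ *-monoʳ-≤ (suc B) (B*[1+B]^j≤B^j*[B+2j] B j (≤-trans 2j≤2[1+j] 2j≤B)) ⟩
    suc B * (B ^ j * (B + 2 * j))             ≡⟨ lemma₂ B (B ^ j) j ⟩
    B ^ j * (B * (B + 2 * j) + (B + 2 * j))   ≤⟨ *-monoʳ-≤ (B ^ j) (+-monoʳ-≤ (B * (B + 2 * j)) (+-monoʳ-≤ B (≤-trans 2j≤2[1+j] 2j≤B))) ⟩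
    B ^ j * (B * (B + 2 * j) + (B + B))       ≡⟨ lemma₃ B (B ^ j) j ⟩
    B * B ^ j * (B + 2 * suc j)               ∎
    where
    open ≤-Reasoning
    2j≤2[1+j] : 2 * j ≤ 2 * suc j
    2j≤2[1+j] = *-monoʳ-≤ 2 (n≤1+n j)
    lemma₁ : ∀ a b c → a * (b * c) ≡ b * (a * c)
    lemma₁ = solve-∀
    lemma₂ : ∀ B X j → suc B * (X * (B + 2 * j)) ≡ X * (B * (B + 2 * j) + (B + 2 * j))
    lemma₂ = solve-∀
    lemma₃ : ∀ B X j → X * (B * (B + 2 * j) + (B + B)) ≡ B * X * (B + 2 * suc j)
    lemma₃ = solve-∀

  a/b≤[1+1/B]^j⇒a/b≤1+2j/B : ∀ a b B .{{_ : NonZero B}} j → 2 * j ≤ B →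
                             a * B ^ j ≤ b * suc B ^ j → a * B ≤ b * (B + 2 * j)
  a/b≤[1+1/B]^j⇒a/b≤1+2j/B a b B j 2j≤B a/b≤ = *-cancelʳ-≤ (a * B) (b * (B + 2 * j)) (B ^ j) ⦃ m^n≢0 B j ⦄ (begin
    a * B * B ^ j              ≡⟨ lemma₁ a B (B ^ j) ⟩
    a * B ^ j * B              ≤⟨ *-monoˡ-≤ B a/b≤ ⟩
    b * suc B ^ j * B          ≡⟨ lemma₂ b (suc B ^ j) B ⟩
    b * (B * suc B ^ j)        ≤⟨ *-monoʳ-≤ b (B*[1+B]^j≤B^j*[B+2j] B j 2j≤B) ⟩
    b * (B ^ j * (B + 2 * j))  ≡⟨ lemma₃ b (B ^ j) (B + 2 * j) ⟩
    b * (B + 2 * j) * B ^ j    ∎)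
    where
    open ≤-Reasoning
    lemma₁ : ∀ x y z → x * y * z ≡ x * z * y
    lemma₁ = solve-∀
    lemma₂ : ∀ x y z → x * y * z ≡ x * (z * y)
    lemma₂ = solve-∀
    lemma₃ : ∀ x y z → x * (y * z) ≡ x * z * y
    lemma₃ = solve-∀

  a/b≤1+2j/B⇒a/b≤1+1/2K : ∀ a b B .{{_ : NonZero B}} j K → 4 * K * j ≤ B →
                           a * B ≤ b * (B + 2 * j) → a * (2 * K) ≤ b * (2 * K + 1)
  a/b≤1+2j/B⇒a/b≤1+1/2K a b B j K 4Kj≤B a/b≤ = *-cancelʳ-≤ (a * (2 * K)) (b * (2 * K + 1)) B (begin
    a * (2 * K) * B                   ≡⟨ lemma₁ a K B ⟩
    a * B * (2 * K)                   ≤⟨ *-monoˡ-≤ (2 * K) a/b≤ ⟩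
    b * (B + 2 * j) * (2 * K)         ≡⟨ lemma₂ b B j K ⟩
    b * (2 * K * B + 4 * K * j)       ≤⟨ *-monoʳ-≤ b (+-monoʳ-≤ (2 * K * B) 4Kj≤B) ⟩
    b * (2 * K * B + B)               ≡⟨ lemma₃ b K B ⟩
    b * (2 * K + 1) * B               ∎)
    where
    open ≤-Reasoning
    lemma₁ : ∀ a K B → a * (2 * K) * B ≡ a * B * (2 * K)
    lemma₁ = solve-∀
    lemma₂ : ∀ b B j K → b * (B + 2 * j) * (2 * K) ≡ b * (2 * K * B + 4 * K * j)
    lemma₂ = solve-∀
    lemma₃ : ∀ b K B → b * (2 * K * B + B) ≡ b * (2 * K + 1) * B
    lemma₃ = solve-∀

  a/b≤1+1/2K∧b/c≤1+1/p⇒a/c≤1+1/K : ∀ a b c K p .{{_ : NonZero p}} → 2 * K + 1 ≤ p →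
                          a * (2 * K) ≤ b * (2 * K + 1) → b * p ≤ c * suc p → a * K ≤ c * suc K
  a/b≤1+1/2K∧b/c≤1+1/p⇒a/c≤1+1/K a b c K p 2K+1≤p a/b≤ b/c≤ = *-cancelʳ-≤ (a * K) (c * suc K) (2 * p) ⦃ m*n≢0 2 p ⦄ (begin
    a * K * (2 * p)              ≡⟨ lemma₁ a K p ⟩
    a * (2 * K) * p              ≤⟨ *-monoˡ-≤ p a/b≤ ⟩
    b * (2 * K + 1) * p          ≡⟨ lemma₂ b K p ⟩
    b * p * (2 * K + 1)          ≤⟨ *-monoˡ-≤ (2 * K + 1) b/c≤ ⟩
    c * suc p * (2 * K + 1)      ≡⟨ lemma₃ c p K ⟩
    c * (2 * K * p + p + (2 * K + 1)) ≤⟨ *-monoʳ-≤ c (+-monoʳ-≤ (2 * K * p + p) 2K+1≤p) ⟩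
    c * (2 * K * p + p + p)      ≡⟨ lemma₄ c K p ⟩
    c * suc K * (2 * p)          ∎)
    where
    open ≤-Reasoning
    lemma₁ : ∀ a K p → a * K * (2 * p) ≡ a * (2 * K) * p
    lemma₁ = solve-∀
    lemma₂ : ∀ b K p → b * (2 * K + 1) * p ≡ b * p * (2 * K + 1)
    lemma₂ = solve-∀
    lemma₃ : ∀ c p K → c * suc p * (2 * K + 1) ≡ c * (2 * K * p + p + (2 * K + 1))
    lemma₃ = solve-∀
    lemma₄ : ∀ c K p → c * (2 * K * p + p + p) ≡ c * suc K * (2 * p)
    lemma₄ = solve-∀

  n<m^n : ∀ {m} n → 1 < m → n < m ^ n
  n<m^n {m} zero    1<m = z<s
  n<m^n {m} (suc n) 1<m = begin-strict
    suc n          ≤⟨ n<m^n n 1<m ⟩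
    m ^ n          <⟨ m<m+n (m ^ n) (m^n>0 m n) ⟩
    m ^ n + m ^ n  ≡⟨ cong (m ^ n +_) (+-identityʳ (m ^ n)) ⟨
    2 * m ^ n      ≤⟨ *-monoˡ-≤ (m ^ n) 1<m ⟩
    m * m ^ n      ∎
    where
    open ≤-Reasoning
    instance _ = >-nonZero (<-trans z<s 1<m)

  n∣n! : ∀ n .{{_ : NonZero n}} → n ∣ n !
  n∣n! (suc n) = m∣m*n (n !)

  -- Every prime factor of N! + 1 exceeds N.
  ∃prime> : ∀ N → ∃ λ p → Prime p × N < p
  ∃prime> N with factorise (suc (N !))
  ... | record { factors = [] ; isFactorisation = 1+N!≡1 } =
    contradiction (suc-injective 1+N!≡1) (≢-nonZero⁻¹ (N !) ⦃ N !≢0 ⦄)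
  ... | record { factors = p ∷ ps ; isFactorisation = 1+N!≡p*∏ ; factorsPrime = pr ∷ _ } = p , pr , ≰⇒> p≰N
    where
    instance _ = prime⇒nonTrivial pr
    p∣1+N! : p ∣ 1 + N !
    p∣1+N! = divides (product ps) (trans 1+N!≡p*∏ (*-comm p (product ps)))
    p≰N : ¬ p ≤ N
    p≰N p≤N = nonTrivial⇒≢1 (∣1⇒≡1 (∣m+n∣m⇒∣n (subst (p ∣_) (+-comm 1 (N !)) p∣1+N!) p∣N!))
      where
      p∣N! : p ∣ N !
      p∣N! = ∣-trans (n∣n! p ⦃ nonTrivial⇒nonZero p ⦄) (m≤n⇒m!∣n! p≤N)

  -- The hypotheses say that m has fewer than B / 4K prime factors, all at least B.
  σ[m]/m≤1+1/2K : ∀ m .{{_ : NonZero m}} B .{{_ : NonZero B}} C .{{_ : NonZero C}} K .{{_ : NonZero K}} →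
                  (∀ {r} → Prime r → r ∣ m → B ≤ r) → C ^ (4 * K) ≤ B → m < C ^ B → σ m * (2 * K) ≤ m * (2 * K + 1)
  σ[m]/m≤1+1/2K m B C K large C^4K≤B m<C^B with j , B^j≤m , σm/m≤[1+1/B]^j ← σ-large-prime-factors m B large =
    a/b≤1+2j/B⇒a/b≤1+1/2K (σ m) m B j K 4Kj≤B (a/b≤[1+1/B]^j⇒a/b≤1+2j/B (σ m) m B j 2j≤B σm/m≤[1+1/B]^j)
    where
    4Kj≤B : 4 * K * j ≤ B
    4Kj≤B = ≮⇒≥ (λ B<4Kj → <-irrefl refl (begin-strict
      C ^ B              ≤⟨ ^-monoʳ-≤ C (<⇒≤ B<4Kj) ⟩
      C ^ (4 * K * j)    ≡⟨ ^-*-assoc C (4 * K) j ⟨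
      (C ^ (4 * K)) ^ j  ≤⟨ ^-monoˡ-≤ j C^4K≤B ⟩
      B ^ j              ≤⟨ B^j≤m ⟩
      m                  <⟨ m<C^B ⟩
      C ^ B              ∎))
      where open ≤-Reasoning
    2j≤B : 2 * j ≤ B
    2j≤B = ≤-trans (*-monoˡ-≤ j (≤-trans (s≤s (s≤s z≤n)) (*-monoʳ-≤ 4 (>-nonZero⁻¹ K)))) 4Kj≤B

  σ[σ[n]]/n≤1+1/K : ∀ K .{{_ : NonZero K}} N → ∃ λ n → N < n × σ (σ n) * K ≤ n * suc K
  σ[σ[n]]/n≤1+1/K K N
    with suc p′ , prp , 2K+1<p ← ∃prime> (2 * K + 1)
    with suc q′ , prq , p^4K+N<q ← ∃prime> (suc p′ ^ (4 * K) + N) = n , N<n , σσn/n≤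
    where
    p = suc p′
    q = suc q′
    n = p ^ q′
    m = geometricSum p q
    2K+1≤p′ : 2 * K + 1 ≤ p′
    2K+1≤p′ = s≤s⁻¹ 2K+1<p
    instance
      _ : NonZero p′
      _ = >-nonZero (≤-trans (m≤n+m 1 (2 * K)) 2K+1≤p′)
      _ : NonZero m
      _ = >-nonZero (≤-trans (m^n>0 p q′) (m≤n+m (p ^ q′) (geometricSum p q′)))
    p^4K+N≤q′ : p ^ (4 * K) + N ≤ q′
    p^4K+N≤q′ = s≤s⁻¹ p^4K+N<q
    N<n : N < n
    N<n = ≤-<-trans (≤-trans (m≤n+m N (p ^ (4 * K))) p^4K+N≤q′) (n<m^n q′ (s≤s (>-nonZero⁻¹ p′)))
    p^4K≤q : p ^ (4 * K) ≤ q
    p^4K≤q = ≤-trans (m≤m+n (p ^ (4 * K)) N) (≤-trans p^4K+N≤q′ (n≤1+n q′))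
    m*p′+1≡p*n : m * p′ + 1 ≡ p * n
    m*p′+1≡p*n = geometricSum-closedForm p′ q
    m<p^q : m < p ^ q
    m<p^q = subst (m <_) m*p′+1≡p*n (≤-<-trans (m≤m*n m p′) (m<m+n (m * p′) z<s))
    m/n≤1+1/p′ : m * p′ ≤ n * p
    m/n≤1+1/p′ = subst (m * p′ ≤_) (trans m*p′+1≡p*n (*-comm p n)) (m≤m+n (m * p′) 1)
    σσn/n≤ : σ (σ n) * K ≤ n * suc K
    σσn/n≤ = subst (λ x → σ x * K ≤ n * suc K) (sym (σ[p^k]≡geometricSum q′ prp))
      (a/b≤1+1/2K∧b/c≤1+1/p⇒a/c≤1+1/K (σ m) m n K p′ 2K+1≤p′
        (σ[m]/m≤1+1/2K m q p K (prime∣geometricSum⇒≤ prq) p^4K≤q m<p^q) m/n≤1+1/p′)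

module Ratios where

  open import Data.Nat as ℕ using (zero; suc)
  import Data.Nat.Properties as ℕ
  open import Data.Nat.Divisibility using (∣1⇒≡1)
  open import Data.Integer as ℤ using (+_)
  import Data.Integer.Properties as ℤ
  open import Data.Rational using (mkℚ; _/_; _≤_; _<_; _+_; _-_; 1ℚ; 0ℚ; toℚᵘ; *<*)
  open import Data.Rational.Properties
  open import Data.Rational.Unnormalised as ℚᵘ using (mkℚᵘ; *≡*) renaming (_≃_ to _≃ᵘ_)
  import Data.Rational.Unnormalised.Properties as ℚᵘ
  open import Data.Product using (∃; _,_)
  open import Relation.Binary.PropositionalEquality
  open import Data.Nat.Tactic.RingSolver using (solve-∀)

  toℚᵘ-⟦⟧ : ∀ a → toℚᵘ ⟦ a ⟧ ≡ mkℚᵘ (+ a) 0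
  toℚᵘ-⟦⟧ a = cong toℚᵘ (normalize-coprime {a} {0} (λ (_ , d∣1) → ∣1⇒≡1 d∣1))

  toℚᵘ-1/1+ : ∀ k → toℚᵘ (+ 1 / suc k) ≡ mkℚᵘ (+ 1) k
  toℚᵘ-1/1+ k = cong toℚᵘ (normalize-coprime {1} {k} (λ (d∣1 , _) → ∣1⇒≡1 d∣1))

  -- In ℚᵘ, comparing such quotients is cross-multiplying naturals.
  toℚᵘ-⟦⟧÷ℕ : ∀ a k → toℚᵘ (⟦ a ⟧ ÷ℕ suc k) ≃ᵘ mkℚᵘ (+ a) k
  toℚᵘ-⟦⟧÷ℕ a k = ℚᵘ.≃-trans (toℚᵘ-homo-* ⟦ a ⟧ (+ 1 / suc k))
    (subst₂ (λ x y → (x ℚᵘ.* y) ≃ᵘ mkℚᵘ (+ a) k) (sym (toℚᵘ-⟦⟧ a)) (sym (toℚᵘ-1/1+ k)) (*≡* (begin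
      + a ℤ.* + 1 ℤ.* + suc k          ≡⟨ cong (ℤ._* + suc k) (ℤ.pos-* a 1) ⟨
      + (a ℕ.* 1) ℤ.* + suc k          ≡⟨ ℤ.pos-* (a ℕ.* 1) (suc k) ⟨
      + (a ℕ.* 1 ℕ.* suc k)            ≡⟨ cong +_ (lemma a k) ⟩
      + (a ℕ.* suc (k ℕ.+ 0 ℕ.* suc k)) ≡⟨ ℤ.pos-* a _ ⟩
      + a ℤ.* + suc (k ℕ.+ 0 ℕ.* suc k) ∎)))
    where
    open ≡-Reasoning
    lemma : ∀ a k → a ℕ.* 1 ℕ.* suc k ≡ a ℕ.* suc (k ℕ.+ 0 ℕ.* suc k)
    lemma = solve-∀

  ⟦⟧÷ℕ-mono-≤ : ∀ a b k l → a ℕ.* suc l ℕ.≤ b ℕ.* suc k → ⟦ a ⟧ ÷ℕ suc k ≤ ⟦ b ⟧ ÷ℕ suc l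
  ⟦⟧÷ℕ-mono-≤ a b k l a/b≤ = toℚᵘ-cancel-≤
    (ℚᵘ.≤-respˡ-≃ (ℚᵘ.≃-sym (toℚᵘ-⟦⟧÷ℕ a k)) (ℚᵘ.≤-respʳ-≃ (ℚᵘ.≃-sym (toℚᵘ-⟦⟧÷ℕ b l))
      (ℚᵘ.*≤* (subst₂ ℤ._≤_ (ℤ.pos-* a (suc l)) (ℤ.pos-* b (suc k)) (ℤ.+≤+ a/b≤)))))

  ÷ℕ-monoˡ-≤ : ∀ n {x y} → x ≤ y → x ÷ℕ n ≤ y ÷ℕ n
  ÷ℕ-monoˡ-≤ zero    x≤y = ≤-refl
  ÷ℕ-monoˡ-≤ (suc k) x≤y = *-monoʳ-≤-nonNeg (+ 1 / suc k) ⦃ normalize-nonNeg 1 (suc k) ⦄ x≤y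

  ∃⟦1⟧÷ℕ≤ : ∀ ε → 0ℚ < ε → ∃ λ k → ⟦ 1 ⟧ ÷ℕ suc k ≤ ε
  ∃⟦1⟧÷ℕ≤ (mkℚ (+ suc a) k _) _ = k , toℚᵘ-cancel-≤ (ℚᵘ.≤-respˡ-≃ (ℚᵘ.≃-sym (toℚᵘ-⟦⟧÷ℕ 1 k))
    (ℚᵘ.*≤* (ℤ.+≤+ (ℕ.*-monoˡ-≤ (suc k) {1} {suc a} (ℕ.s≤s ℕ.z≤n)))))
  ∃⟦1⟧÷ℕ≤ (mkℚ (+ zero) _ _)    (*<* (ℤ.+<+ ()))
  ∃⟦1⟧÷ℕ≤ (mkℚ ℤ.-[1+ _ ] _ _) (*<* ())

  ⟦2+k⟧÷ℕ[1+k]≤1+⟦1⟧÷ℕ[1+k] : ∀ k → ⟦ 2 ℕ.+ k ⟧ ÷ℕ suc k ≤ 1ℚ + ⟦ 1 ⟧ ÷ℕ suc k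
  ⟦2+k⟧÷ℕ[1+k]≤1+⟦1⟧÷ℕ[1+k] k = toℚᵘ-cancel-≤
    (ℚᵘ.≤-respˡ-≃ (ℚᵘ.≃-sym (toℚᵘ-⟦⟧÷ℕ (2 ℕ.+ k) k))
    (ℚᵘ.≤-respʳ-≃ (ℚᵘ.≃-sym (toℚᵘ-homo-+ 1ℚ (⟦ 1 ⟧ ÷ℕ suc k)))
    (ℚᵘ.≤-respʳ-≃ (ℚᵘ.+-congʳ (toℚᵘ 1ℚ) (ℚᵘ.≃-sym (toℚᵘ-⟦⟧÷ℕ 1 k))) (ℚᵘ.≤-reflexive (*≡* (begin
      + (2 ℕ.+ k) ℤ.* + suc (k ℕ.+ 0 ℕ.* suc k)              ≡⟨ ℤ.pos-* (2 ℕ.+ k) (suc (k ℕ.+ 0 ℕ.* suc k)) ⟨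
      + ((2 ℕ.+ k) ℕ.* suc (k ℕ.+ 0 ℕ.* suc k))              ≡⟨ cong +_ (lemma k) ⟩
      + ((1 ℕ.* suc k ℕ.+ 1 ℕ.* 1) ℕ.* suc k)                ≡⟨ ℤ.pos-* (1 ℕ.* suc k ℕ.+ 1 ℕ.* 1) (suc k) ⟩
      + (1 ℕ.* suc k ℕ.+ 1 ℕ.* 1) ℤ.* + suc k                ≡⟨ cong (ℤ._* + suc k) numerator ⟩
      (+ 1 ℤ.* + suc k ℤ.+ + 1 ℤ.* + 1) ℤ.* + suc k          ∎))))))
    where
    open ≡-Reasoning
    numerator : + (1 ℕ.* suc k ℕ.+ 1 ℕ.* 1) ≡ + 1 ℤ.* + suc k ℤ.+ + 1 ℤ.* + 1
    numerator = trans (ℤ.pos-+ (1 ℕ.* suc k) (1 ℕ.* 1)) (cong₂ ℤ._+_ (ℤ.pos-* 1 (suc k)) (ℤ.pos-* 1 1))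
    lemma : ∀ k → (2 ℕ.+ k) ℕ.* suc (k ℕ.+ 0 ℕ.* suc k) ≡ (1 ℕ.* suc k ℕ.+ 1 ℕ.* 1) ℕ.* suc k
    lemma = solve-∀

  p-q≤p : ∀ p {q} → 0ℚ ≤ q → p - q ≤ p
  p-q≤p p 0≤q = ≤-trans (+-monoʳ-≤ p (neg-antimono-≤ 0≤q)) (≤-reflexive (+-identityʳ p))

  1≤⟦a⟧÷ℕn : ∀ a n .{{_ : ℕ.NonZero n}} → n ℕ.≤ a → 1ℚ ≤ ⟦ a ⟧ ÷ℕ n
  1≤⟦a⟧÷ℕn a (suc m) n≤a = ⟦⟧÷ℕ-mono-≤ 1 a 0 m (subst₂ ℕ._≤_ (sym (ℕ.*-identityˡ (suc m))) (sym (ℕ.*-identityʳ a)) n≤a)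

  ⟦a⟧÷ℕn≤1+⟦1⟧÷ℕ[1+k] : ∀ a n .{{_ : ℕ.NonZero n}} k → a ℕ.* suc k ℕ.≤ n ℕ.* (2 ℕ.+ k) →
                        ⟦ a ⟧ ÷ℕ n ≤ 1ℚ + ⟦ 1 ⟧ ÷ℕ suc k
  ⟦a⟧÷ℕn≤1+⟦1⟧÷ℕ[1+k] a (suc m) k a/n≤ =
    ≤-trans (⟦⟧÷ℕ-mono-≤ a (2 ℕ.+ k) m k (subst (a ℕ.* suc k ℕ.≤_) (ℕ.*-comm (suc m) (2 ℕ.+ k)) a/n≤)) (⟦2+k⟧÷ℕ[1+k]≤1+⟦1⟧÷ℕ[1+k] k)

open DivisorSums using (n≤σ[n])
open SigmaOfSigma using (σ[σ[n]]/n≤1+1/K)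
open Ratios using (∃⟦1⟧÷ℕ≤; p-q≤p; 1≤⟦a⟧÷ℕn; ÷ℕ-monoˡ-≤; ⟦a⟧÷ℕn≤1+⟦1⟧÷ℕ[1+k])
open import Data.Nat using (ℕ; suc; s≤s)
import Data.Nat.Properties as ℕ
open import Data.Rational using (ℚ; _≤_; 1ℚ; _+_; _-_)
open import Data.Rational.Properties using (+-monoʳ-≤; <⇒≤; module ≤-Reasoning)
open import Data.Product using (∃; _×_; _,_; proj₁; proj₂)

theorem5 : (h : ℕ → ℚ)
    → (∃ λ n₀ → (n : ℕ) → n₀ Data.Nat.≤ n → ⟦ n ⟧ ≤ h n × h n ≤ ⟦ σ n ⟧)
    → LimInfEq (λ n → h (σ n) ÷ℕ n) 1ℚ
theorem5 h (n₀ , h-bounds) ε 0<ε with k , 1/[1+k]≤ε ← ∃⟦1⟧÷ℕ≤ ε 0<ε = (suc n₀ , eventually≥) , frequently≤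
  where
  n₀≤σ : ∀ n .{{_ : Data.Nat.NonZero n}} → n₀ Data.Nat.≤ n → n₀ Data.Nat.≤ σ n
  n₀≤σ n n₀≤n = ℕ.≤-trans n₀≤n (n≤σ[n] n)
  eventually≥ : ∀ n → suc n₀ Data.Nat.≤ n → 1ℚ - ε ≤ h (σ n) ÷ℕ n
  eventually≥ n@(suc m) (s≤s n₀≤m) = begin
    1ℚ - ε           ≤⟨ p-q≤p 1ℚ (<⇒≤ 0<ε) ⟩
    1ℚ               ≤⟨ 1≤⟦a⟧÷ℕn (σ n) n (n≤σ[n] n) ⟩
    ⟦ σ n ⟧ ÷ℕ n     ≤⟨ ÷ℕ-monoˡ-≤ n (proj₁ (h-bounds (σ n) (n₀≤σ n (ℕ.m≤n⇒m≤1+n n₀≤m)))) ⟩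
    h (σ n) ÷ℕ n     ∎
    where open ≤-Reasoning
  frequently≤ : ∀ N → ∃ λ n → N Data.Nat.≤ n × h (σ n) ÷ℕ n ≤ 1ℚ + ε
  frequently≤ N with n@(suc m) , N+n₀<n , σσn/n≤ ← σ[σ[n]]/n≤1+1/K (suc k) (N Data.Nat.+ n₀) =
    n , ℕ.≤-trans (ℕ.m≤m+n N n₀) (ℕ.<⇒≤ N+n₀<n) , (begin
      h (σ n) ÷ℕ n           ≤⟨ ÷ℕ-monoˡ-≤ n (proj₂ (h-bounds (σ n) (n₀≤σ n (ℕ.≤-trans (ℕ.m≤n+m n₀ N) (ℕ.<⇒≤ N+n₀<n))))) ⟩
      ⟦ σ (σ n) ⟧ ÷ℕ n       ≤⟨ ⟦a⟧÷ℕn≤1+⟦1⟧÷ℕ[1+k] (σ (σ n)) n k σσn/n≤ ⟩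
      1ℚ + ⟦ 1 ⟧ ÷ℕ suc k    ≤⟨ +-monoʳ-≤ 1ℚ 1/[1+k]≤ε ⟩
      1ℚ + ε                 ∎)
    where open ≤-Reasoning
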